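{- Let $n\ge0$ and $0\leq k\leq p^n$. Then $V_{k,n}$ has dimension $k$, and its orthogonal for the pairing $\langle\cdot,\cdot\rangle$ is $V_{k,n}^\perp=V_{p^n-k,n}$.
   Context: $p$ is a prime, $E$ a finite extension of $\mathbf{F}_p$; binomial coefficients $\binom{j}{i}$ are defined by $(1+X)^j=\sum_i\binom{j}{i}X^i$, in $\mathbf{F}_p$. $V_n=E^{p^n}$ is the space of sequences $(x_0,\dots,x_{p^n-1})$, with the perfect pairing $\langle x,y\rangle=\sum_{j=0}^{p^n-1}x_jy_j$. For $k\ge0$, $v_{k,n}=\left(\binom{0}{k},\binom{1}{k},\dots,\binom{p^n-1}{k}\right)\in V_n$, and $V_{k,n}$ is the subspace spanned by $v_{0,n},\dots,v_{k-1,n}$. -}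

module Defs where

open import Level using (Level; _⊔_)
open import Data.Nat using (ℕ; zero; suc; _^_)
open import Data.Nat.Combinatorics using (_C_)
open import Data.Fin using (Fin; toℕ)
import Data.Fin as F
open import Data.Product using (Σ; ∃; _×_; _,_)
open import Relation.Nullary using (¬_)
open import Algebra.Bundles using (CommutativeRing)

record Field (c ℓ : Level) : Set (Level.suc (c ⊔ ℓ)) where
  field
    commutativeRing : CommutativeRing c ℓ
  open CommutativeRing commutativeRing public
  field
    0≉1 : ¬ (0# ≈ 1#)
    inverse : ∀ x → ¬ (x ≈ 0#) → Σ Carrier (λ y → (x * y) ≈ 1#)

module FieldDefs {c ℓ : Level} (E : Field c ℓ) where
  open Field E

  ι : ℕ → Carrier
  ι zero = 0#
  ι (suc m) = 1# + ι m

  IsFinite : Set (c ⊔ ℓ)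
  IsFinite = Σ ℕ (λ m → Σ (Fin m → Carrier) (λ enum → ∀ x → Σ (Fin m) (λ i → enum i ≈ x)))

  HasChar : ℕ → Set ℓ
  HasChar p = ι p ≈ 0#

  Vect : ℕ → Set c
  Vect N = Fin N → Carrier

  ∑ : ∀ N → (Fin N → Carrier) → Carrier
  ∑ zero f = 0#
  ∑ (suc N) f = f F.zero + ∑ N (λ i → f (F.suc i))

  ⟨_,_⟩ : ∀ {N} → Vect N → Vect N → Carrier
  ⟨_,_⟩ {N} x y = ∑ N (λ j → x j * y j)

  linComb : ∀ {N m} → (Fin m → Vect N) → (Fin m → Carrier) → Vect N
  linComb {N} {m} b a j = ∑ m (λ i → a i * b i j)

  Span : ∀ {N m} → (Fin m → Vect N) → Vect N → Set (c ⊔ ℓ)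
  Span {N} {m} b x = Σ (Fin m → Carrier) (λ a → ∀ j → x j ≈ linComb b a j)

  LinIndep : ∀ {N m} → (Fin m → Vect N) → Set (c ⊔ ℓ)
  LinIndep {N} {m} b = ∀ a → (∀ j → linComb b a j ≈ 0#) → ∀ i → a i ≈ 0#

  HasDim : ∀ {N} {w} → (Vect N → Set w) → ℕ → Set (c ⊔ ℓ ⊔ w)
  HasDim {N} W d = Σ (Fin d → Vect N) (λ b →
    (∀ i → W (b i)) × LinIndep b × (∀ x → W x → Span b x))

  Orth : ∀ {N} {w} → (Vect N → Set w) → Vect N → Set (c ⊔ ℓ ⊔ w)
  Orth {N} W x = ∀ y → W y → ⟨ x , y ⟩ ≈ 0#

  module _ (p : ℕ) where
    v : ℕ → (n : ℕ) → Vect (p ^ n)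
    v k n j = ι (toℕ j C k)

    Vsub : ℕ → (n : ℕ) → Vect (p ^ n) → Set (c ⊔ ℓ)
    Vsub k n = Span {p ^ n} {k} (λ i → v (toℕ i) n)

{-# OPTIONS --safe #-}
-- For N = p^n let G i j = ⟨v_i, v_j⟩ be the Gram matrix of the binomial vectors. By the hockey-stick identity
-- G 0 j = C(N, j+1), and by the discrete product rule G (i+1) j + G i (j+1) + G i j = C(N, i+1) C(N, j+1).
-- In characteristic p every C(N, m) with 0 < m < N vanishes, so G i j = 0 whenever i + j + 2 ≤ N, and
-- G i j = ±1 on the antidiagonal i + j + 1 = N. This gives V_{N-k} ⊆ V_k^⊥. Conversely, expand x in the basis v_0, …, v_{N-1}
-- (Newton's forward differences): orthogonality to v_0, …, v_{k-1} kills the top k coefficients one antidiagonal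
-- at a time. The v_i are independent because v_i vanishes before position i and equals 1 there.
module Submission where

open import Defs
open import Level using (Level; _⊔_)
open import Data.Nat as Nat using (ℕ; zero; suc; pred; _^_; _∸_; _≤_; _<_; z≤n; s≤s; _≤?_)
open import Data.Nat.Properties
  using (+-suc; m≤m+n; n≤1+n; n<1+n; m<n⇒m<1+n; ≤-trans; ≤-reflexive; <⇒≱; ≰⇒>; ≤-antisym;
         +-mono-≤; +-monoˡ-≤; m∸n+n≡m; m∸n≤m; module ≤-Reasoning)
import Data.Nat.Properties as NatP
open import Data.Nat.Combinatorics using (_C_; nCk+nC[k+1]≡[n+1]C[k+1]; nCn≡1; nC1≡n; k>n⇒nCk≡0)
open import Data.Nat.Divisibility using (_∣_; _∣?_; divides; 1∣_; m∣m*n; ∣-trans; ∣⇒≤; *-monoʳ-∣; *-cancelˡ-∣)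
open import Data.Nat.Primality using (Prime; euclidsLemma; prime⇒nonZero)
open import Data.Nat.Solver using (module +-*-Solver)
open import Data.Fin as F using (Fin; toℕ; inject₁; inject≤; fromℕ<)
open import Data.Fin.Properties using (toℕ<n; toℕ-inject₁; toℕ-inject≤; toℕ-fromℕ<)
open import Data.Fin.Induction using (<-weakInduction; <-wellFounded)
open import Data.Vec.Functional using (_∷_)
open import Data.Product using (_×_; _,_)
open import Data.Sum using (inj₁; inj₂)
open import Data.Maybe using (nothing)
open import Function.Base using (_∘_)
open import Function.Bundles using (_⇔_; mk⇔)
open import Induction.WellFounded using (module All)
open import Relation.Nullary using (¬_; yes; no; contradiction)
open import Relation.Binary.PropositionalEquality as ≡ using (_≡_)
open import Algebra.Bundles using (CommutativeRing)
open import Tactic.RingSolver using (solve-∀)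
open import Tactic.RingSolver.Core.AlmostCommutativeRing using (AlmostCommutativeRing; fromCommutativeRing)

module _ where
  open Nat using (_+_; _*_)
  open import Data.Nat.Properties using (*-comm; *-assoc; *-zeroʳ; *-identityˡ; *-identityʳ)

  [k+1]*nC[k+1]≡n*[n-1]Ck : ∀ n k → suc k * (n C suc k) ≡ n * (pred n C k)
  [k+1]*nC[k+1]≡n*[n-1]Ck zero k = *-zeroʳ (suc k)
  [k+1]*nC[k+1]≡n*[n-1]Ck (suc n) zero = ≡.trans (*-identityˡ _) (≡.trans (nC1≡n (suc n)) (≡.sym (*-identityʳ _)))
  [k+1]*nC[k+1]≡n*[n-1]Ck (suc zero) (suc k) = *-zeroʳ (suc (suc k))
  [k+1]*nC[k+1]≡n*[n-1]Ck (suc (suc n)) (suc k) = begin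
    suc (suc k) * (suc (suc n) C suc (suc k))
      ≡⟨ ≡.cong (suc (suc k) *_) (nCk+nC[k+1]≡[n+1]C[k+1] (suc n) (suc k)) ⟨
    suc (suc k) * (A + B)
      ≡⟨ solve 3 (λ k A B → (con 2 :+ k) :* (A :+ B) := A :+ (con 1 :+ k) :* A :+ (con 2 :+ k) :* B) ≡.refl k A B ⟩
    A + suc k * A + suc (suc k) * B
      ≡⟨ ≡.cong₂ (λ u w → A + u + w) ([k+1]*nC[k+1]≡n*[n-1]Ck (suc n) k) ([k+1]*nC[k+1]≡n*[n-1]Ck (suc n) (suc k)) ⟩
    A + suc n * (n C k) + suc n * (n C suc k)
      ≡⟨ solve 4 (λ A n x y → A :+ (con 1 :+ n) :* x :+ (con 1 :+ n) :* y := A :+ (con 1 :+ n) :* (x :+ y))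
                 ≡.refl A n (n C k) (n C suc k) ⟩
    A + suc n * (n C k + n C suc k)
      ≡⟨ ≡.cong (λ u → A + suc n * u) (nCk+nC[k+1]≡[n+1]C[k+1] n k) ⟩
    suc (suc n) * A
      ∎
    where
    open ≡.≡-Reasoning
    open +-*-Solver
    A = suc n C suc k
    B = suc n C suc (suc k)

  <∸-+-<⇒2+m+n≤o : ∀ {m n o k} → k ≤ o → m < o ∸ k → n < k → 2 + m + n ≤ o
  <∸-+-<⇒2+m+n≤o {m} {n} {o} {k} k≤o m<o∸k n<k = begin
    2 + m + n        ≡⟨ ≡.cong suc (+-suc m n) ⟨
    suc m + suc n    ≤⟨ +-mono-≤ m<o∸k n<k ⟩
    o ∸ k + k        ≡⟨ m∸n+n≡m k≤o ⟩
    o                ∎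
    where open ≤-Reasoning

  module _ {p : ℕ} (p-prime : Prime p) where
    private instance
      p≢0 = prime⇒nonZero p-prime

    p^n∣m*c⇒p^n∣m : ∀ n {m c} → ¬ p ∣ c → p ^ n ∣ m * c → p ^ n ∣ m
    p^n∣m*c⇒p^n∣m zero {m} _ _ = 1∣ m
    p^n∣m*c⇒p^n∣m (suc n) {m} {c} p∤c p^[n+1]∣mc with euclidsLemma m c p-prime (∣-trans (m∣m*n (p ^ n)) p^[n+1]∣mc)
    ... | inj₂ p∣c = contradiction p∣c p∤c
    ... | inj₁ (divides q ≡.refl) = ≡.subst (p ^ suc n ∣_) (*-comm p q) (*-monoʳ-∣ p p^n∣q)
      where
      p^n∣q : p ^ n ∣ q
      p^n∣q = p^n∣m*c⇒p^n∣m n p∤c (*-cancelˡ-∣ p (≡.subst (p ^ suc n ∣_) qp*c≡p*qc p^[n+1]∣mc))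
        where
        qp*c≡p*qc : q * p * c ≡ p * (q * c)
        qp*c≡p*qc = ≡.trans (≡.cong (_* c) (*-comm q p)) (*-assoc p q c)

    p∣[p^n]Cm : ∀ n {m} → 0 < m → m < p ^ n → p ∣ p ^ n C m
    p∣[p^n]Cm n {suc k} _ m<p^n with p ∣? (p ^ n C suc k)
    ... | yes p∣ = p∣
    ... | no p∤ = contradiction (∣⇒≤ (p^n∣m*c⇒p^n∣m n p∤ p^n∣[k+1]*C)) (<⇒≱ m<p^n)
      where
      p^n∣[k+1]*C : p ^ n ∣ suc k * (p ^ n C suc k)
      p^n∣[k+1]*C = ≡.subst (p ^ n ∣_) (≡.sym ([k+1]*nC[k+1]≡n*[n-1]Ck (p ^ n) k)) (m∣m*n _)

module _ {c ℓ : Level} (R : CommutativeRing c ℓ) where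
  private
    R′ : AlmostCommutativeRing c ℓ
    R′ = fromCommutativeRing R (λ _ → nothing)   -- the solver never needs to test for zero
  open AlmostCommutativeRing R′

  [a+b][c+d]≈bd+[bc+ad+ac] : ∀ a b c d → (a + b) * (c + d) ≈ b * d + (b * c + a * d + a * c)
  [a+b][c+d]≈bd+[bc+ad+ac] = solve-∀ R′

module BinomialVectors {c ℓ : Level} (E : Field c ℓ) where
  open Field E
  open FieldDefs E
  open import Relation.Binary.Reasoning.Setoid setoid
  open import Algebra.Properties.Ring ring
    using (+-inverseˡ-unique; //-rightDividesˡ; -‿involutive; -0#≈0#; -‿distribˡ-*; -‿distribʳ-*)
  open import Algebra.Properties.Semiring.Mult semiring using (×-homo-+; ×1-homo-*) renaming (_×_ to _×ℕ_)
  open import Algebra.Properties.CommutativeSemigroup +-commutativeSemigroup using (interchange)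

  ι≈×1 : ∀ m → ι m ≈ m ×ℕ 1#
  ι≈×1 zero = refl
  ι≈×1 (suc m) = +-congˡ (ι≈×1 m)

  ι-homo-+ : ∀ m n → ι (m Nat.+ n) ≈ ι m + ι n
  ι-homo-+ m n = begin
    ι (m Nat.+ n)      ≈⟨ ι≈×1 (m Nat.+ n) ⟩
    (m Nat.+ n) ×ℕ 1#  ≈⟨ ×-homo-+ 1# m n ⟩
    m ×ℕ 1# + n ×ℕ 1#  ≈⟨ +-cong (ι≈×1 m) (ι≈×1 n) ⟨
    ι m + ι n          ∎

  ι-homo-* : ∀ m n → ι (m Nat.* n) ≈ ι m * ι n
  ι-homo-* m n = begin
    ι (m Nat.* n)          ≈⟨ ι≈×1 (m Nat.* n) ⟩
    (m Nat.* n) ×ℕ 1#      ≈⟨ ×1-homo-* m n ⟩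
    (m ×ℕ 1#) * (n ×ℕ 1#)  ≈⟨ *-cong (ι≈×1 m) (ι≈×1 n) ⟨
    ι m * ι n              ∎

  ι-pascal : ∀ x k → ι (suc x C suc k) ≈ ι (x C k) + ι (x C suc k)
  ι-pascal x k = trans (reflexive (≡.cong ι (≡.sym (nCk+nC[k+1]≡[n+1]C[k+1] x k)))) (ι-homo-+ (x C k) (x C suc k))

  ι1≈1 : ι 1 ≈ 1#
  ι1≈1 = +-identityʳ 1#

  ι-char-multiple : ∀ {p m} → HasChar p → p ∣ m → ι m ≈ 0#
  ι-char-multiple {p} char (divides q ≡.refl) = trans (ι-homo-* q p) (trans (*-congˡ char) (zeroʳ _))

  ∑-cong : ∀ N {f g : Fin N → Carrier} → (∀ i → f i ≈ g i) → ∑ N f ≈ ∑ N g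
  ∑-cong zero f≈g = refl
  ∑-cong (suc N) f≈g = +-cong (f≈g F.zero) (∑-cong N (f≈g ∘ F.suc))

  ∑-zero : ∀ N {f : Fin N → Carrier} → (∀ i → f i ≈ 0#) → ∑ N f ≈ 0#
  ∑-zero zero f≈0 = refl
  ∑-zero (suc N) f≈0 = trans (+-cong (f≈0 F.zero) (∑-zero N (f≈0 ∘ F.suc))) (+-identityˡ 0#)

  ∑-distrib-+ : ∀ N (f g : Fin N → Carrier) → ∑ N (λ i → f i + g i) ≈ ∑ N f + ∑ N g
  ∑-distrib-+ zero f g = sym (+-identityˡ 0#)
  ∑-distrib-+ (suc N) f g = trans (+-congˡ (∑-distrib-+ N (f ∘ F.suc) (g ∘ F.suc))) (interchange _ _ _ _)

  *-distribˡ-∑ : ∀ N a (f : Fin N → Carrier) → a * ∑ N f ≈ ∑ N (λ i → a * f i)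
  *-distribˡ-∑ zero a f = zeroʳ a
  *-distribˡ-∑ (suc N) a f = trans (distribˡ _ _ _) (+-congˡ (*-distribˡ-∑ N a (f ∘ F.suc)))

  *-distribʳ-∑ : ∀ N a (f : Fin N → Carrier) → ∑ N f * a ≈ ∑ N (λ i → f i * a)
  *-distribʳ-∑ N a f = trans (*-comm _ _) (trans (*-distribˡ-∑ N a f) (∑-cong N (λ i → *-comm _ _)))

  ∑-comm : ∀ M N (f : Fin M → Fin N → Carrier) → ∑ N (λ j → ∑ M (λ i → f i j)) ≈ ∑ M (λ i → ∑ N (f i))
  ∑-comm M zero f = sym (∑-zero M (λ _ → refl))
  ∑-comm M (suc N) f = trans (+-congˡ (∑-comm M N (λ i → f i ∘ F.suc))) (sym (∑-distrib-+ M _ _))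

  ∑-select : ∀ N (f : Fin N → Carrier) t → (∀ i → i F.< t → f i ≈ 0#) → (∀ i → t F.< i → f i ≈ 0#) →
             ∑ N f ≈ f t
  ∑-select (suc N) f F.zero _ f>≈0 = trans (+-congˡ (∑-zero N (λ i → f>≈0 (F.suc i) (s≤s z≤n)))) (+-identityʳ _)
  ∑-select (suc N) f (F.suc t) f<≈0 f>≈0 = trans (+-congʳ (f<≈0 F.zero (s≤s z≤n))) (trans (+-identityˡ _)
    (∑-select N (f ∘ F.suc) t (λ i i<t → f<≈0 (F.suc i) (s≤s i<t)) (λ i t<i → f>≈0 (F.suc i) (s≤s t<i))))

  ∑-inject≤ : ∀ {K N} (K≤N : K ≤ N) (f : Fin N → Carrier) → (∀ i → K ≤ toℕ i → f i ≈ 0#) →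
              ∑ N f ≈ ∑ K (λ i → f (inject≤ i K≤N))
  ∑-inject≤ {N = N} z≤n f f≈0 = ∑-zero N (λ i → f≈0 i z≤n)
  ∑-inject≤ (s≤s K≤N) f f≈0 = +-congˡ (∑-inject≤ K≤N (f ∘ F.suc) (λ i K≤i → f≈0 (F.suc i) (s≤s K≤i)))

  ∑-telescope : ∀ N (G g : ℕ → Carrier) → (∀ x → G (suc x) ≈ G x + g x) → G 0 + ∑ N (λ i → g (toℕ i)) ≈ G N
  ∑-telescope zero G g step = +-identityʳ _
  ∑-telescope (suc N) G g step = begin
    G 0 + (g 0 + ∑ N (λ i → g (suc (toℕ i))))  ≈⟨ +-assoc _ _ _ ⟨
    (G 0 + g 0) + ∑ N (λ i → g (suc (toℕ i)))  ≈⟨ +-congʳ (step 0) ⟨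
    G 1 + ∑ N (λ i → g (suc (toℕ i)))          ≈⟨ ∑-telescope N (G ∘ suc) (g ∘ suc) (step ∘ suc) ⟩
    G (suc N)                                  ∎

  ⟨⟩-cong : ∀ {N} {x x′ y y′ : Vect N} → (∀ j → x j ≈ x′ j) → (∀ j → y j ≈ y′ j) →
            ⟨ x , y ⟩ ≈ ⟨ x′ , y′ ⟩
  ⟨⟩-cong {N} x≈x′ y≈y′ = ∑-cong N (λ j → *-cong (x≈x′ j) (y≈y′ j))

  ⟨⟩-comm : ∀ {N} (x y : Vect N) → ⟨ x , y ⟩ ≈ ⟨ y , x ⟩
  ⟨⟩-comm {N} x y = ∑-cong N (λ j → *-comm _ _)

  ⟨linComb,⟩ : ∀ {N m} (b : Fin m → Vect N) a (y : Vect N) → ⟨ linComb b a , y ⟩ ≈ ∑ m (λ i → a i * ⟨ b i , y ⟩)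
  ⟨linComb,⟩ {N} {m} b a y = begin
    ∑ N (λ j → ∑ m (λ i → a i * b i j) * y j)  ≈⟨ ∑-cong N (λ j → *-distribʳ-∑ m (y j) _) ⟩
    ∑ N (λ j → ∑ m (λ i → a i * b i j * y j))  ≈⟨ ∑-comm m N _ ⟩
    ∑ m (λ i → ∑ N (λ j → a i * b i j * y j))  ≈⟨ ∑-cong m (λ i → trans (∑-cong N (λ j → *-assoc _ _ _))
                                                                          (sym (*-distribˡ-∑ N (a i) _))) ⟩
    ∑ m (λ i → a i * ⟨ b i , y ⟩)              ∎

  Span-member : ∀ {N m} (b : Fin m → Vect N) i → Span b (b i)
  Span-member {m = suc m} b F.zero = (1# ∷ λ _ → 0#) , λ j →
    sym (trans (+-cong (*-identityˡ _) (∑-zero m (λ _ → zeroˡ _))) (+-identityʳ _))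
  Span-member b (F.suc i) with Span-member (b ∘ F.suc) i
  ... | a , bi≈ = (0# ∷ a) , λ j → trans (bi≈ j) (sym (trans (+-congʳ (zeroˡ _)) (+-identityˡ _)))

  Orth-Span : ∀ {N m} {b : Fin m → Vect N} {u} → (∀ l → ⟨ u , b l ⟩ ≈ 0#) → Orth (Span b) u
  Orth-Span {m = m} {b} {u} u⊥b y (a , y≈) = begin
    ⟨ u , y ⟩                        ≈⟨ ⟨⟩-comm u y ⟩
    ⟨ y , u ⟩                        ≈⟨ ⟨⟩-cong y≈ (λ _ → refl) ⟩
    ⟨ linComb b a , u ⟩              ≈⟨ ⟨linComb,⟩ b a u ⟩
    ∑ m (λ l → a l * ⟨ b l , u ⟩)   ≈⟨ ∑-zero m (λ l → trans (*-congˡ (trans (⟨⟩-comm (b l) u) (u⊥b l)))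
                                                             (zeroʳ _)) ⟩
    0#                               ∎

  Span⊆Orth-Span : ∀ {N m m′} {b : Fin m → Vect N} {b′ : Fin m′ → Vect N} →
                   (∀ i l → ⟨ b i , b′ l ⟩ ≈ 0#) → ∀ x → Span b x → Orth (Span b′) x
  Span⊆Orth-Span {b = b} {b′} b⊥b′ x x∈ =
    Orth-Span (λ l → trans (⟨⟩-comm x (b′ l)) (Orth-Span (λ i → trans (⟨⟩-comm (b′ l) (b i)) (b⊥b′ i l)) x x∈))

  binom : ∀ N → ℕ → Vect N
  binom N k j = ι (toℕ j C k)

  BinomSpan : ∀ N → ℕ → Vect N → Set (c ⊔ ℓ)
  BinomSpan N k = Span {N} {k} (binom N ∘ toℕ)

  gram : ∀ N → ℕ → ℕ → Carrier
  gram N i j = ⟨ binom N i , binom N j ⟩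

  gram-zeroˡ : ∀ N j → gram N 0 j ≈ ι (N C suc j)
  gram-zeroˡ N j = begin
    gram N 0 j                      ≈⟨ ∑-cong N (λ x → trans (*-congʳ ι1≈1) (*-identityˡ _)) ⟩
    ∑ N (λ x → ι (toℕ x C j))       ≈⟨ +-identityˡ _ ⟨
    0# + ∑ N (λ x → ι (toℕ x C j))  ≈⟨ ∑-telescope N (λ x → ι (x C suc j)) (λ x → ι (x C j)) step ⟩
    ι (N C suc j)                   ∎
    where
    step : ∀ x → ι (suc x C suc j) ≈ ι (x C suc j) + ι (x C j)
    step x = trans (ι-pascal x j) (+-comm _ _)

  gram-pascal : ∀ N i j → gram N (suc i) j + gram N i (suc j) + gram N i j ≈ ι (N C suc i) * ι (N C suc j)
  gram-pascal N i j = begin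
    gram N (suc i) j + gram N i (suc j) + gram N i j         ≈⟨ +-congʳ (∑-distrib-+ N _ _) ⟨
    ∑ N (λ x → u (toℕ x) (suc i) * u (toℕ x) j + u (toℕ x) i * u (toℕ x) (suc j)) + gram N i j
                                                             ≈⟨ ∑-distrib-+ N _ _ ⟨
    ∑ N (λ x → g (toℕ x))                                    ≈⟨ +-identityˡ _ ⟨
    0# + ∑ N (λ x → g (toℕ x))                               ≈⟨ +-congʳ (zeroˡ 0#) ⟨
    0# * 0# + ∑ N (λ x → g (toℕ x))                          ≈⟨ ∑-telescope N (λ x → u x (suc i) * u x (suc j)) g step ⟩
    ι (N C suc i) * ι (N C suc j)                            ∎
    where
    u : ℕ → ℕ → Carrier
    u x k = ι (x C k)
    g : ℕ → Carrier
    g x = u x (suc i) * u x j + u x i * u x (suc j) + u x i * u x j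
    step : ∀ x → u (suc x) (suc i) * u (suc x) (suc j) ≈ u x (suc i) * u x (suc j) + g x
    step x = trans (*-cong (ι-pascal x i) (ι-pascal x j))
                   ([a+b][c+d]≈bd+[bc+ad+ac] commutativeRing (u x i) (u x (suc i)) (u x j) (u x (suc j)))

  binom∈BinomSpan : ∀ {N k r} → r < k → BinomSpan N k (binom N r)
  binom∈BinomSpan {N} r<k =
    ≡.subst (BinomSpan N _ ∘ binom N) (toℕ-fromℕ< r<k) (Span-member (binom N ∘ toℕ) (fromℕ< r<k))

  binom-linIndep : ∀ {N K} → K ≤ N → LinIndep {N} {K} (binom N ∘ toℕ)
  binom-linIndep {N} {K} K≤N a a·binom≈0 = All.wfRec <-wellFounded _ (λ i → a i ≈ 0#) a≈0
    where
    a≈0 : ∀ i → (∀ {i′} → i′ F.< i → a i′ ≈ 0#) → a i ≈ 0#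
    a≈0 i ih = begin
      a i                                         ≈⟨ *-identityʳ _ ⟨
      a i * 1#                                    ≈⟨ *-congˡ binom-diagonal ⟨
      a i * binom N (toℕ i) j                     ≈⟨ ∑-select K _ i below above ⟨
      linComb (binom N ∘ toℕ) a j                 ≈⟨ a·binom≈0 j ⟩
      0#                                          ∎
      where
      j = inject≤ i K≤N
      binom-diagonal : binom N (toℕ i) j ≈ 1#
      binom-diagonal =
        trans (reflexive (≡.cong ι (≡.trans (≡.cong (_C toℕ i) (toℕ-inject≤ i K≤N)) (nCn≡1 (toℕ i))))) ι1≈1
      below : ∀ i′ → i′ F.< i → a i′ * binom N (toℕ i′) j ≈ 0#
      below i′ i′<i = trans (*-congʳ (ih i′<i)) (zeroˡ _)
      above : ∀ i′ → i F.< i′ → a i′ * binom N (toℕ i′) j ≈ 0#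
      above i′ i<i′ = trans (*-congˡ (reflexive (≡.cong ι (k>n⇒nCk≡0 j<i′)))) (zeroʳ _)
        where
        j<i′ : toℕ j < toℕ i′
        j<i′ = ≡.subst (_< toℕ i′) (≡.sym (toℕ-inject≤ i K≤N)) i<i′

  binom-spans : ∀ N (x : Vect N) → BinomSpan N N x
  binom-spans zero x = (λ ()) , (λ ())
  binom-spans (suc M) x with binom-spans M (λ j → x (F.suc j) - x (inject₁ j))
  ... | b , Δx≈ = (x F.zero ∷ b) , <-weakInduction (λ j → x j ≈ x F.zero * ι 1 + S (toℕ j)) base step
    where
    S : ℕ → Carrier
    S t = ∑ M (λ l → b l * ι (t C suc (toℕ l)))
    S-suc : ∀ t → S (suc t) ≈ S t + ∑ M (λ l → b l * ι (t C toℕ l))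
    S-suc t = trans (∑-cong M (λ l → trans (*-congˡ (trans (ι-pascal t (toℕ l)) (+-comm _ _))) (distribˡ _ _ _)))
                    (∑-distrib-+ M _ _)
    base : x F.zero ≈ x F.zero * ι 1 + S 0
    base = sym (trans (+-cong (trans (*-congˡ ι1≈1) (*-identityʳ _)) (∑-zero M (λ _ → zeroʳ _))) (+-identityʳ _))
    step : ∀ j → x (inject₁ j) ≈ x F.zero * ι 1 + S (toℕ (inject₁ j)) → x (F.suc j) ≈ x F.zero * ι 1 + S (suc (toℕ j))
    step j x≈ = begin
      x (F.suc j)                                                  ≈⟨ //-rightDividesˡ (x (inject₁ j)) (x (F.suc j)) ⟨
      (x (F.suc j) - x (inject₁ j)) + x (inject₁ j)                ≈⟨ +-comm _ _ ⟩
      x (inject₁ j) + (x (F.suc j) - x (inject₁ j))                ≈⟨ +-cong x≈ (Δx≈ j) ⟩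
      x F.zero * ι 1 + S (toℕ (inject₁ j)) + linComb (binom M ∘ toℕ) b j
                                                                   ≈⟨ +-assoc _ _ _ ⟩
      x F.zero * ι 1 + (S (toℕ (inject₁ j)) + linComb (binom M ∘ toℕ) b j)
                                                                   ≈⟨ +-congˡ (+-congʳ (reflexive (≡.cong S (toℕ-inject₁ j)))) ⟩
      x F.zero * ι 1 + (S (toℕ j) + linComb (binom M ∘ toℕ) b j)   ≈⟨ +-congˡ (S-suc (toℕ j)) ⟨
      x F.zero * ι 1 + S (suc (toℕ j))                             ∎

  sign : ℕ → Carrier
  sign zero = 1#
  sign (suc i) = - sign i

  sign*sign≈1 : ∀ i → sign i * sign i ≈ 1#
  sign*sign≈1 zero = *-identityˡ 1#
  sign*sign≈1 (suc i) = begin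
    - sign i * - sign i      ≈⟨ -‿distribˡ-* _ _ ⟨
    - (sign i * - sign i)    ≈⟨ -‿cong (-‿distribʳ-* _ _) ⟨
    - - (sign i * sign i)    ≈⟨ -‿involutive _ ⟩
    sign i * sign i          ≈⟨ sign*sign≈1 i ⟩
    1#                       ∎

  *-sign≈0⇒≈0 : ∀ {x} i → x * sign i ≈ 0# → x ≈ 0#
  *-sign≈0⇒≈0 {x} i x·sign≈0 = begin
    x                         ≈⟨ *-identityʳ x ⟨
    x * 1#                    ≈⟨ *-congˡ (sign*sign≈1 i) ⟨
    x * (sign i * sign i)     ≈⟨ *-assoc _ _ _ ⟨
    x * sign i * sign i       ≈⟨ *-congʳ x·sign≈0 ⟩
    0# * sign i               ≈⟨ zeroˡ _ ⟩
    0#                        ∎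

  MiddleBinomialsVanish : ℕ → Set ℓ
  MiddleBinomialsVanish N = ∀ m → 0 < m → m < N → ι (N C m) ≈ 0#

  p^n-middleBinomialsVanish : ∀ {p} → Prime p → HasChar p → ∀ n → MiddleBinomialsVanish (p ^ n)
  p^n-middleBinomialsVanish p-prime char n m 0<m m<p^n = ι-char-multiple char (p∣[p^n]Cm p-prime n 0<m m<p^n)

  module _ {N} (vanish : MiddleBinomialsVanish N) where
    gram-vanish : ∀ i j → 2 Nat.+ i Nat.+ j ≤ N → gram N i j ≈ 0#
    gram-suc : ∀ i j → 2 Nat.+ i Nat.+ j ≤ N → gram N (suc i) j ≈ - gram N i (suc j)

    gram-suc i j 2+i+j≤N = +-inverseˡ-unique _ _ (begin
      gram N (suc i) j + gram N i (suc j)                 ≈⟨ +-identityʳ _ ⟨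
      gram N (suc i) j + gram N i (suc j) + 0#            ≈⟨ +-congˡ (gram-vanish i j 2+i+j≤N) ⟨
      gram N (suc i) j + gram N i (suc j) + gram N i j    ≈⟨ gram-pascal N i j ⟩
      ι (N C suc i) * ι (N C suc j)                       ≈⟨ *-congʳ (vanish (suc i) (s≤s z≤n) 1+i<N) ⟩
      0# * ι (N C suc j)                                  ≈⟨ zeroˡ _ ⟩
      0#                                                  ∎)
      where
      1+i<N : suc i < N
      1+i<N = ≤-trans (s≤s (s≤s (m≤m+n i j))) 2+i+j≤N

    gram-vanish zero j 2+j≤N = trans (gram-zeroˡ N j) (vanish (suc j) (s≤s z≤n) 2+j≤N)
    gram-vanish (suc i) j 3+i+j≤N = begin
      gram N (suc i) j      ≈⟨ gram-suc i j (≤-trans (n≤1+n _) 3+i+j≤N) ⟩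
      - gram N i (suc j)    ≈⟨ -‿cong (gram-vanish i (suc j) 2+i+[1+j]≤N) ⟩
      - 0#                  ≈⟨ -0#≈0# ⟩
      0#                    ∎
      where
      2+i+[1+j]≤N : 2 Nat.+ i Nat.+ suc j ≤ N
      2+i+[1+j]≤N = ≡.subst (λ t → 2 Nat.+ t ≤ N) (≡.sym (+-suc i j)) 3+i+j≤N

    gram-antidiagonal : ∀ i j → 1 Nat.+ i Nat.+ j ≡ N → gram N i j ≈ sign i
    gram-antidiagonal zero j 1+j≡N =
      trans (gram-zeroˡ N j) (trans (reflexive (≡.cong ι (≡.trans (≡.cong (N C_) 1+j≡N) (nCn≡1 N)))) ι1≈1)
    gram-antidiagonal (suc i) j 2+i+j≡N =
      trans (gram-suc i j (≤-reflexive 2+i+j≡N))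
            (-‿cong (gram-antidiagonal i (suc j) (≡.trans (≡.cong suc (+-suc i j)) 2+i+j≡N)))

    BinomSpan-orthogonal : ∀ k → k ≤ N → ∀ x → BinomSpan N (N ∸ k) x → Orth (BinomSpan N k) x
    BinomSpan-orthogonal k k≤N =
      Span⊆Orth-Span (λ i l → gram-vanish (toℕ i) (toℕ l) (<∸-+-<⇒2+m+n≤o k≤N (toℕ<n i) (toℕ<n l)))

    antidiagonal-coefficient-vanishes : ∀ (a : Fin N → Carrier) k l → 1 Nat.+ toℕ l Nat.+ k ≡ N →
      ∑ N (λ l′ → a l′ * gram N (toℕ l′) k) ≈ 0# → (∀ l′ → N ≤ toℕ l′ Nat.+ k → a l′ ≈ 0#) → a l ≈ 0#
    antidiagonal-coefficient-vanishes a k l 1+l+k≡N a·gram≈0 lower = *-sign≈0⇒≈0 (toℕ l) (begin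
      a l * sign (toℕ l)                      ≈⟨ *-congˡ (gram-antidiagonal (toℕ l) k 1+l+k≡N) ⟨
      a l * gram N (toℕ l) k                  ≈⟨ ∑-select N _ l below above ⟨
      ∑ N (λ l′ → a l′ * gram N (toℕ l′) k)   ≈⟨ a·gram≈0 ⟩
      0#                                      ∎)
      where
      below : ∀ l′ → l′ F.< l → a l′ * gram N (toℕ l′) k ≈ 0#
      below l′ l′<l =
        trans (*-congˡ (gram-vanish (toℕ l′) k (≤-trans (s≤s (+-monoˡ-≤ k l′<l)) (≤-reflexive 1+l+k≡N)))) (zeroʳ _)
      above : ∀ l′ → l F.< l′ → a l′ * gram N (toℕ l′) k ≈ 0#
      above l′ l<l′ = trans (*-congʳ (lower l′ (≡.subst (_≤ toℕ l′ Nat.+ k) 1+l+k≡N (+-monoˡ-≤ k l<l′)))) (zeroˡ _)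

    coefficients-vanish : ∀ (a : Fin N → Carrier) k → (∀ r → r < k → ∑ N (λ l → a l * gram N (toℕ l) r) ≈ 0#) →
                          ∀ l → N ≤ toℕ l Nat.+ k → a l ≈ 0#
    coefficients-vanish a zero _ l N≤l+0 =
      contradiction (≡.subst (N ≤_) (NatP.+-identityʳ (toℕ l)) N≤l+0) (<⇒≱ (toℕ<n l))
    coefficients-vanish a (suc k) a·gram≈0 l N≤l+1+k with N ≤? toℕ l Nat.+ k
    ... | yes N≤l+k = coefficients-vanish a k (λ r r<k → a·gram≈0 r (m<n⇒m<1+n r<k)) l N≤l+k
    ... | no N≰l+k = antidiagonal-coefficient-vanishes a k l 1+l+k≡N (a·gram≈0 k (n<1+n k))
                       (coefficients-vanish a k (λ r r<k → a·gram≈0 r (m<n⇒m<1+n r<k)))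
      where
      1+l+k≡N : 1 Nat.+ toℕ l Nat.+ k ≡ N
      1+l+k≡N = ≤-antisym (≰⇒> N≰l+k) (≡.subst (N ≤_) (+-suc (toℕ l) k) N≤l+1+k)

    Orth⇒BinomSpan : ∀ k → k ≤ N → ∀ x → Orth (BinomSpan N k) x → BinomSpan N (N ∸ k) x
    Orth⇒BinomSpan k k≤N x x⊥ with binom-spans N x
    ... | a , x≈ = (λ l → a (inject≤ l N∸k≤N)) , λ j → begin
      x j
        ≈⟨ x≈ j ⟩
      ∑ N (λ l → a l * binom N (toℕ l) j)
        ≈⟨ ∑-inject≤ N∸k≤N _ (high-terms-vanish j) ⟩
      ∑ (N ∸ k) (λ l → a (inject≤ l N∸k≤N) * binom N (toℕ (inject≤ l N∸k≤N)) j)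
        ≈⟨ ∑-cong (N ∸ k) (λ l → *-congˡ (binom-cong (toℕ-inject≤ l N∸k≤N))) ⟩
      ∑ (N ∸ k) (λ l → a (inject≤ l N∸k≤N) * binom N (toℕ l) j)
        ∎
      where
      N∸k≤N : N ∸ k ≤ N
      N∸k≤N = m∸n≤m N k
      binom-cong : ∀ {t t′ j} → t ≡ t′ → binom N t j ≈ binom N t′ j
      binom-cong t≡t′ = reflexive (≡.cong (λ t → binom N t _) t≡t′)
      a·gram≈0 : ∀ r → r < k → ∑ N (λ l → a l * gram N (toℕ l) r) ≈ 0#
      a·gram≈0 r r<k = begin
        ∑ N (λ l → a l * gram N (toℕ l) r)         ≈⟨ ⟨linComb,⟩ (binom N ∘ toℕ) a (binom N r) ⟨
        ⟨ linComb (binom N ∘ toℕ) a , binom N r ⟩  ≈⟨ ⟨⟩-cong (λ j → sym (x≈ j)) (λ _ → refl) ⟩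
        ⟨ x , binom N r ⟩                          ≈⟨ x⊥ (binom N r) (binom∈BinomSpan r<k) ⟩
        0#                                         ∎
      high-terms-vanish : ∀ j l → N ∸ k ≤ toℕ l → a l * binom N (toℕ l) j ≈ 0#
      high-terms-vanish j l N∸k≤l = trans (*-congʳ (coefficients-vanish a k a·gram≈0 l N≤l+k)) (zeroˡ _)
        where
        N≤l+k : N ≤ toℕ l Nat.+ k
        N≤l+k = ≡.subst (_≤ toℕ l Nat.+ k) (m∸n+n≡m k≤N) (+-monoˡ-≤ k N∸k≤l)

lemma1p1p3 : ∀ {c ℓ : Level} (E : Field c ℓ) (p : ℕ) → Prime p →
    FieldDefs.IsFinite E → FieldDefs.HasChar E p →
    ∀ (n k : ℕ) → k ≤ p ^ n →
      FieldDefs.HasDim E (FieldDefs.Vsub E p k n) k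
      × (∀ x → FieldDefs.Orth E (FieldDefs.Vsub E p k n) x ⇔ FieldDefs.Vsub E p (p ^ n ∸ k) n x)
lemma1p1p3 E p p-prime _ char n k k≤p^n =
  (binom (p ^ n) ∘ toℕ , Span-member _ , binom-linIndep k≤p^n , λ _ x∈ → x∈) ,
  λ x → mk⇔ (Orth⇒BinomSpan vanish k k≤p^n x) (BinomSpan-orthogonal vanish k k≤p^n x)
  where
  open BinomialVectors E
  vanish : MiddleBinomialsVanish (p ^ n)
  vanish = p^n-middleBinomialsVanish p-prime char n
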